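{- Let $f(x)=\dfrac{1}{x^2}\sum_{k=0}^\infty\dfrac{x^{2^{k+1}}}{1+x^{2^{k+1}}}$. Then for every $m\ge0$: $H_{6m}(f)\equiv H_{6m+1}(f)\equiv1$, $H_{6m+2}(f)\equiv H_{6m+3}(f)\equiv0$, $H_{6m+4}(f)\equiv H_{6m+5}(f)\equiv1\pmod 2$.
   Context: For $f=\sum a_ix^i$, $H_n(f)=\det(a_{i+j})_{0\le i,j\le n-1}$ for $n\ge1$ and $H_0(f)=1$. -}

module Defs where

open import Data.Nat as ℕ using (ℕ; zero; suc)
open import Data.Nat.Divisibility using (_∣?_; quotient)
open import Data.Integer using (ℤ; +_; -1ℤ; _^_; _*_; _+_)
open import Data.Fin using (Fin; zero; suc; toℕ; punchIn)
open import Relation.Nullary using (yes; no)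

sumℕ : ℕ → (ℕ → ℤ) → ℤ
sumℕ zero    g = + 0
sumℕ (suc n) g = sumℕ n g + g n

sumFin : ∀ n → (Fin n → ℤ) → ℤ
sumFin zero    g = + 0
sumFin (suc n) g = g zero + sumFin n (λ i → g (suc i))

det : ∀ n → (Fin n → Fin n → ℤ) → ℤ
det zero    M = + 1
det (suc n) M =
  sumFin (suc n) (λ j → (-1ℤ ^ toℕ j) * (M zero j * det n (λ r c → M (suc r) (punchIn j c))))

-- Coefficient of x^e in x^d/(1+x^d) = Σ_{j≥1} (-1)^(j+1) x^(j d)   (d ≥ 1)
alt : ℕ → ℤ
alt zero    = + 0
alt (suc j) = -1ℤ ^ j

geoCoeff : ℕ → ℕ → ℤ
geoCoeff d e with d ∣? e
... | yes p = alt (quotient p)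
... | no  _ = + 0

-- Coefficient of x^i in f(x) = x^(-2) Σ_{k≥0} x^(2^(k+1))/(1+x^(2^(k+1))),
-- i.e. coefficient of x^(i+2) in the sum. Terms with k ≥ i+2 have 2^(k+1) > i+2
-- and contribute nothing, so the sum over k < i+2 is exact.
fCoeff : ℕ → ℤ
fCoeff i = sumℕ (i ℕ.+ 2) (λ k → geoCoeff (2 ℕ.^ suc k) (i ℕ.+ 2))

H : ℕ → ℤ
H n = det n (λ i j → fCoeff (toℕ i ℕ.+ toℕ j))

-- Reduce everything mod 2, where determinants are permanents. Over 𝔽₂ the series
-- g = x² f = Σₖ x^(2^(k+1)) / (1 + x^(2^(k+1))) satisfies g + g(x²) = x²/(1 + x²), hence,
-- by Frobenius, the quadratic equation g + g² = x²/(1 + x²).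
-- If F P = x^k with P(0) = 1, row operations by the Toeplitz matrix of P give
-- H_(n+k+1)(F) = H_n(P / x^(k+2)) over 𝔽₂. Thanks to the quadratic equation, four such steps,
-- with k = 0, 2, 0, 0, lead from f back to f; so H_n(f) mod 2 has period 6, and its first six
-- values are 1, 1, 0, 0, 1, 1.

module Submission where

open import Defs

open import Data.Empty using (⊥-elim)
open import Data.Fin using (Fin; zero; suc; toℕ; punchIn)
open import Data.Fin.Properties using (toℕ<n; toℕ-inject₁; toℕ-fromℕ)
open import Data.Integer as ℤ using (ℤ; +_; -[1+_]; -1ℤ; _⊖_; ∣_∣; _-_)
open import Data.Integer.Divisibility using (_∣_)
open import Data.Integer.Properties using ([1+m]⊖[1+n]≡m⊖n; abs-*)
open import Data.Nat using (ℕ; zero; suc; _+_; _*_; _^_; _∸_; _<_; _≤_; _>_; s≤s; s≤s⁻¹; z≤n; parity)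
open import Data.Nat.Divisibility
  using (divides; _∣?_; 1∣_; >⇒∤; ∣-trans; m∣m*n; *-cancelˡ-∣; *-monoʳ-∣) renaming (_∣_ to _∣ℕ_)
open import Data.Nat.Properties
  using (+-suc; n∸n≡0; m+n∸m≡n; m+[n∸m]≡n; m∸[m∸n]≡n; [m+n]∸[m+o]≡n∸o; <-≤-trans; <⇒≤; ≤-refl; ≤-trans;
         m<n⇒m<1+n; m≤m+n; +-mono-≤; m^n>0)
  renaming (+-comm to +ℕ-comm; +-assoc to +ℕ-assoc; +-identityʳ to +ℕ-identityʳ)
open import Data.Nat.Tactic.RingSolver using (solve-∀)
open import Data.Parity.Base using (Parity; 0ℙ; 1ℙ) renaming (_+_ to infixl 6 _⊕_; _*_ to infixl 7 _·_)
open import Data.Parity.Properties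
  using (+-*-semiring; +-commutativeSemigroup; *-commutativeSemigroup; +-0-abelianGroup;
         +-assoc; +-comm; +-identityʳ; p+p≡0ℙ; p⁻¹+p≡1ℙ; *-comm; *-assoc; *-idem; *-identityʳ; *-zeroʳ;
         *-distribˡ-+; *-distribʳ-+; +-homo-+; *-homo-*)
open import Data.Product using (_×_; _,_)
open import Function using (_∘_)
open import Relation.Binary.PropositionalEquality
open import Relation.Nullary using (¬_; yes; no)

open import Algebra.Properties.AbelianGroup +-0-abelianGroup using (xyx⁻¹≈y)
open import Algebra.Properties.CommutativeSemigroup +-commutativeSemigroup
  using () renaming (x∙yz≈y∙xz to x⊕yz≡y⊕xz; x∙yz≈xz∙y to x⊕yz≡xz⊕y)
open import Algebra.Properties.CommutativeSemigroup *-commutativeSemigroup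
  using () renaming (x∙yz≈y∙xz to x·yz≡y·xz)
open import Algebra.Properties.Semiring.Sum +-*-semiring
  using (sum-syntax; sum-cong-≗; ∑-distrib-+; ∑-comm; *-distribˡ-sum; sum-replicate-zero; sum-init-last)
open ≡-Reasoning

∑-linear : ∀ n (a b d : Fin n → Parity) x →
  ∑[ j < n ] ((a j ⊕ x · b j) · d j) ≡ ∑[ j < n ] (a j · d j) ⊕ x · ∑[ j < n ] (b j · d j)
∑-linear n a b d x = begin
  ∑[ j < n ] ((a j ⊕ x · b j) · d j)
    ≡⟨ sum-cong-≗ (λ j → trans (*-distribʳ-+ (d j) (a j) (x · b j)) (cong (a j · d j ⊕_) (*-assoc x (b j) (d j)))) ⟩
  ∑[ j < n ] (a j · d j ⊕ x · (b j · d j))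
    ≡⟨ ∑-distrib-+ (λ j → a j · d j) (λ j → x · (b j · d j)) ⟩
  ∑[ j < n ] (a j · d j) ⊕ ∑[ j < n ] (x · (b j · d j))
    ≡⟨ cong (∑[ j < n ] (a j · d j) ⊕_) (*-distribˡ-sum x (λ j → b j · d j)) ⟨
  ∑[ j < n ] (a j · d j) ⊕ x · ∑[ j < n ] (b j · d j) ∎

∑ℕ : ℕ → (ℕ → Parity) → Parity
∑ℕ n h = ∑[ i < n ] h (toℕ i)

∑ℕ-cong : ∀ n {g h : ℕ → Parity} → (∀ t → t < n → g t ≡ h t) → ∑ℕ n g ≡ ∑ℕ n h
∑ℕ-cong n g≡h = sum-cong-≗ (λ i → g≡h (toℕ i) (toℕ<n i))

∑ℕ-vanish : ∀ n (h : ℕ → Parity) → (∀ t → t < n → h t ≡ 0ℙ) → ∑ℕ n h ≡ 0ℙ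
∑ℕ-vanish n h h≡0 = trans (∑ℕ-cong n h≡0) (sum-replicate-zero n)

∑ℕ-suc : ∀ n h → ∑ℕ (suc n) h ≡ ∑ℕ n h ⊕ h n
∑ℕ-suc n h = trans (sum-init-last {n} (h ∘ toℕ))
  (cong₂ _⊕_ (sum-cong-≗ {n} (cong h ∘ toℕ-inject₁)) (cong h (toℕ-fromℕ n)))

∑ℕ-+ : ∀ m n h → ∑ℕ (m + n) h ≡ ∑ℕ m h ⊕ ∑ℕ n (λ t → h (m + t))
∑ℕ-+ zero    n h = refl
∑ℕ-+ (suc m) n h = trans (cong (h 0 ⊕_) (∑ℕ-+ m n (h ∘ suc))) (sym (+-assoc (h 0) _ _))

∑ℕ-reverse : ∀ n h → ∑ℕ n (λ t → h (n ∸ suc t)) ≡ ∑ℕ n h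
∑ℕ-reverse zero    h = refl
∑ℕ-reverse (suc n) h = begin
  h n ⊕ ∑ℕ n (λ t → h (n ∸ suc t)) ≡⟨ cong (h n ⊕_) (∑ℕ-reverse n h) ⟩
  h n ⊕ ∑ℕ n h                     ≡⟨ +-comm (h n) _ ⟩
  ∑ℕ n h ⊕ h n                     ≡⟨ ∑ℕ-suc n h ⟨
  ∑ℕ (suc n) h                     ∎

-- Determinants over 𝔽₂

Matrix : ℕ → Set
Matrix n = Fin n → Fin n → Parity

minor : ∀ {n} → Fin (suc n) → Matrix (suc n) → Matrix n
minor j M r c = M (suc r) (punchIn j c)

detℙ : ∀ n → Matrix n → Parity
detℙ zero    M = 1ℙ
detℙ (suc n) M = ∑[ j < suc n ] (M zero j · detℙ n (minor j M))

detℙ-cong : ∀ n {M N : Matrix n} → (∀ i j → M i j ≡ N i j) → detℙ n M ≡ detℙ n N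
detℙ-cong zero    M≗N = refl
detℙ-cong (suc n) M≗N =
  sum-cong-≗ (λ j → cong₂ _·_ (M≗N zero j) (detℙ-cong n (λ r c → M≗N (suc r) (punchIn j c))))

-- An ordered pair of distinct columns (j, j′) of Fin (suc n) is encoded as (j, c) with
-- j′ = punchIn j c; swapping the pair gives (punchIn j c, punchBack j c).
punchBack : ∀ {n} → Fin (suc n) → Fin n → Fin n
punchBack {suc n} zero    c       = zero
punchBack {suc n} (suc j) zero    = j
punchBack {suc n} (suc j) (suc c) = suc (punchBack j c)

punchIn-punchBack : ∀ {n} (j : Fin (suc n)) (c : Fin n) → punchIn (punchIn j c) (punchBack j c) ≡ j
punchIn-punchBack {suc n} zero    zero    = refl
punchIn-punchBack {suc n} zero    (suc c) = refl
punchIn-punchBack {suc n} (suc j) zero    = refl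
punchIn-punchBack {suc n} (suc j) (suc c) = cong suc (punchIn-punchBack j c)

punchIn-punchIn-punchBack : ∀ {n} (j : Fin (suc (suc n))) (c : Fin (suc n)) (d : Fin n) →
  punchIn j (punchIn c d) ≡ punchIn (punchIn j c) (punchIn (punchBack j c) d)
punchIn-punchIn-punchBack zero    zero    d       = refl
punchIn-punchIn-punchBack zero    (suc c) d       = refl
punchIn-punchIn-punchBack (suc j) zero    d       = refl
punchIn-punchIn-punchBack (suc j) (suc c) zero    = refl
punchIn-punchIn-punchBack (suc j) (suc c) (suc d) = cong suc (punchIn-punchIn-punchBack j c d)

∑pairs : ∀ n → (Fin (suc n) → Fin n → Parity) → Parity
∑pairs n h = ∑[ j < suc n ] ∑[ c < n ] h j c

∑pairs-swap : ∀ n (h : Fin (suc n) → Fin n → Parity) →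
  ∑pairs n h ≡ ∑pairs n (λ j c → h (punchIn j c) (punchBack j c))
∑pairs-swap zero    h = refl
∑pairs-swap (suc n) h = begin
  A ⊕ ∑[ j < suc n ] (h (suc j) zero ⊕ ∑[ c < n ] h (suc j) (suc c))
    ≡⟨ cong (A ⊕_) (∑-distrib-+ (λ j → h (suc j) zero) (λ j → ∑[ c < n ] h (suc j) (suc c))) ⟩
  A ⊕ (B ⊕ ∑pairs n (λ j c → h (suc j) (suc c)))
    ≡⟨ cong (λ x → A ⊕ (B ⊕ x)) (∑pairs-swap n (λ j c → h (suc j) (suc c))) ⟩
  A ⊕ (B ⊕ ∑pairs n h′)
    ≡⟨ x⊕yz≡y⊕xz A B _ ⟩
  B ⊕ (A ⊕ ∑pairs n h′)
    ≡⟨ cong (B ⊕_) (∑-distrib-+ (h zero) (λ j → ∑[ c < n ] h′ j c)) ⟨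
  B ⊕ ∑[ j < suc n ] (h zero j ⊕ ∑[ c < n ] h′ j c)
    ∎
  where
  A = ∑[ c < suc n ] h zero c
  B = ∑[ j < suc n ] h (suc j) zero
  h′ = λ j c → h (suc (punchIn j c)) (suc (punchBack j c))

-- The swap is a fixed-point-free involution, so an invariant summand is counted twice.
∑pairs-swap-invariant : ∀ n (h : Fin (suc n) → Fin n → Parity) →
  (∀ j c → h j c ≡ h (punchIn j c) (punchBack j c)) → ∑pairs n h ≡ 0ℙ
∑pairs-swap-invariant zero    h inv = refl
∑pairs-swap-invariant (suc n) h inv = begin
  A ⊕ ∑[ j < suc n ] (h (suc j) zero ⊕ ∑[ c < n ] h (suc j) (suc c))
    ≡⟨ cong (A ⊕_) (∑-distrib-+ (λ j → h (suc j) zero) (λ j → ∑[ c < n ] h (suc j) (suc c))) ⟩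
  A ⊕ (∑[ j < suc n ] h (suc j) zero ⊕ ∑pairs n (λ j c → h (suc j) (suc c)))
    ≡⟨ cong₂ (λ x y → A ⊕ (x ⊕ y)) (sum-cong-≗ (λ j → inv (suc j) zero))
         (∑pairs-swap-invariant n (λ j c → h (suc j) (suc c)) (λ j c → inv (suc j) (suc c))) ⟩
  A ⊕ (A ⊕ 0ℙ)
    ≡⟨ cong (A ⊕_) (+-identityʳ A) ⟩
  A ⊕ A
    ≡⟨ p+p≡0ℙ A ⟩
  0ℙ ∎
  where A = ∑[ c < suc n ] h zero c

pairTerm : ∀ n → Matrix (suc (suc n)) → Fin (suc (suc n)) → Fin (suc n) → Parity
pairTerm n M j c = M zero j · (M (suc zero) (punchIn j c) · detℙ n (minor c (minor j M)))

detℙ-expand₂ : ∀ n (M : Matrix (suc (suc n))) → detℙ (suc (suc n)) M ≡ ∑pairs (suc n) (pairTerm n M)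
detℙ-expand₂ n M =
  sum-cong-≗ (λ j → *-distribˡ-sum (M zero j) (λ c → M (suc zero) (punchIn j c) · detℙ n (minor c (minor j M))))

swap₀₁ : ∀ {n} → Fin (suc (suc n)) → Fin (suc (suc n))
swap₀₁ zero          = suc zero
swap₀₁ (suc zero)    = zero
swap₀₁ (suc (suc i)) = suc (suc i)

pairTerm-swap : ∀ n (M : Matrix (suc (suc n))) j c →
  pairTerm n M (punchIn j c) (punchBack j c) ≡ pairTerm n (M ∘ swap₀₁) j c
pairTerm-swap n M j c = begin
  M zero (punchIn j c) · (M (suc zero) (punchIn (punchIn j c) (punchBack j c)) · D′)
    ≡⟨ cong₂ (λ x y → M zero (punchIn j c) · (M (suc zero) x · y)) (punchIn-punchBack j c) D′≡D ⟩
  M zero (punchIn j c) · (M (suc zero) j · D)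
    ≡⟨ x·yz≡y·xz (M zero (punchIn j c)) (M (suc zero) j) D ⟩
  M (suc zero) j · (M zero (punchIn j c) · D) ∎
  where
  D  = detℙ n (minor c (minor j M))
  D′ = detℙ n (minor (punchBack j c) (minor (punchIn j c) M))
  D′≡D : D′ ≡ D
  D′≡D = detℙ-cong n (λ r d → cong (M (suc (suc r))) (sym (punchIn-punchIn-punchBack j c d)))

detℙ-swap₀₁ : ∀ n (M : Matrix (suc (suc n))) → detℙ (suc (suc n)) (M ∘ swap₀₁) ≡ detℙ (suc (suc n)) M
detℙ-swap₀₁ n M = begin
  detℙ (suc (suc n)) (M ∘ swap₀₁)
    ≡⟨ detℙ-expand₂ n (M ∘ swap₀₁) ⟩
  ∑pairs (suc n) (pairTerm n (M ∘ swap₀₁))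
    ≡⟨ sum-cong-≗ (λ j → sum-cong-≗ (λ c → pairTerm-swap n M j c)) ⟨
  ∑pairs (suc n) (λ j c → pairTerm n M (punchIn j c) (punchBack j c))
    ≡⟨ ∑pairs-swap (suc n) (pairTerm n M) ⟨
  ∑pairs (suc n) (pairTerm n M)
    ≡⟨ detℙ-expand₂ n M ⟨
  detℙ (suc (suc n)) M ∎

detℙ-equalRows₀₁ : ∀ n (M : Matrix (suc (suc n))) → (∀ j → M zero j ≡ M (suc zero) j) →
  detℙ (suc (suc n)) M ≡ 0ℙ
detℙ-equalRows₀₁ n M same = trans (detℙ-expand₂ n M) (∑pairs-swap-invariant (suc n) (pairTerm n M) invariant)
  where
  invariant : ∀ j c → pairTerm n M j c ≡ pairTerm n M (punchIn j c) (punchBack j c)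
  invariant j c = trans (cong₂ (λ x y → x · (y · detℙ n (minor c (minor j M)))) (same j) (sym (same (punchIn j c))))
                        (sym (pairTerm-swap n M j c))

addRow₀ : ∀ {n} → (Fin n → Parity) → Matrix (suc n) → Matrix (suc n)
addRow₀ c M zero    j = M zero j
addRow₀ c M (suc i) j = M (suc i) j ⊕ c i · M zero j

-- Swapping the first two rows turns the operation into one on the first row of each minor.
detℙ-addRow₀ : ∀ n c (M : Matrix (suc n)) → detℙ (suc n) (addRow₀ c M) ≡ detℙ (suc n) M
detℙ-addRow₀ zero    c M = refl
detℙ-addRow₀ (suc n) c M = begin
  detℙ (suc (suc n)) (addRow₀ c M)
    ≡⟨ detℙ-swap₀₁ n (addRow₀ c M) ⟨
  ∑[ j < suc (suc n) ] ((M (suc zero) j ⊕ c zero · M zero j) · detℙ (suc n) (minor j (addRow₀ c M ∘ swap₀₁)))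
    ≡⟨ sum-cong-≗ (λ j → cong ((M (suc zero) j ⊕ c zero · M zero j) ·_) (minor-addRow₀ j)) ⟩
  ∑[ j < suc (suc n) ] ((M (suc zero) j ⊕ c zero · M zero j) · detℙ (suc n) (minor j (M ∘ swap₀₁)))
    ≡⟨ ∑-linear (suc (suc n)) (M (suc zero)) (M zero) (λ j → detℙ (suc n) (minor j (M ∘ swap₀₁))) (c zero) ⟩
  detℙ (suc (suc n)) (M ∘ swap₀₁) ⊕ c zero · detℙ (suc (suc n)) M₀₀
    ≡⟨ cong₂ (λ x y → x ⊕ c zero · y) (detℙ-swap₀₁ n M) (detℙ-equalRows₀₁ n M₀₀ (λ j → refl)) ⟩
  detℙ (suc (suc n)) M ⊕ c zero · 0ℙ
    ≡⟨ trans (cong (detℙ (suc (suc n)) M ⊕_) (*-zeroʳ (c zero))) (+-identityʳ _) ⟩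
  detℙ (suc (suc n)) M ∎
  where
  minor-addRow₀ : ∀ j → detℙ (suc n) (minor j (addRow₀ c M ∘ swap₀₁)) ≡ detℙ (suc n) (minor j (M ∘ swap₀₁))
  minor-addRow₀ j = trans
    (detℙ-cong (suc n) {minor j (addRow₀ c M ∘ swap₀₁)} {addRow₀ (c ∘ suc) (minor j (M ∘ swap₀₁))}
      (λ { zero d → refl ; (suc r) d → refl }))
    (detℙ-addRow₀ n (c ∘ suc) (minor j (M ∘ swap₀₁)))
  M₀₀ : Matrix (suc (suc n))
  M₀₀ zero    = M zero
  M₀₀ (suc i) = M (swap₀₁ (suc i))

rows : ∀ n → (ℕ → Fin n → Parity) → Matrix n
rows n R i = R (toℕ i)

lowerOp : ∀ {C : Set} → (ℕ → ℕ → Parity) → (ℕ → C → Parity) → ℕ → C → Parity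
lowerOp K R i c = R i c ⊕ ∑ℕ i (λ s → K i s · R s c)

detℙ-lowerOp : ∀ n K (R : ℕ → Fin n → Parity) → detℙ n (rows n (lowerOp K R)) ≡ detℙ n (rows n R)
detℙ-lowerOp zero    K R = refl
detℙ-lowerOp (suc n) K R = begin
  detℙ (suc n) (rows (suc n) (lowerOp K R))
    ≡⟨ detℙ-cong (suc n) split ⟩
  detℙ (suc n) (addRow₀ (λ i → K (suc (toℕ i)) 0) (rows (suc n) R′))
    ≡⟨ detℙ-addRow₀ n (λ i → K (suc (toℕ i)) 0) (rows (suc n) R′) ⟩
  ∑[ j < suc n ] (R 0 j · detℙ n (rows n (lowerOp K′ (R/ j))))
    ≡⟨ sum-cong-≗ (λ j → cong (R 0 j ·_) (detℙ-lowerOp n K′ (R/ j))) ⟩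
  detℙ (suc n) (rows (suc n) R) ∎
  where
  K′ : ℕ → ℕ → Parity
  K′ i s = K (suc i) (suc s)
  R/ : Fin (suc n) → ℕ → Fin n → Parity
  R/ j i c = R (suc i) (punchIn j c)
  R′ : ℕ → Fin (suc n) → Parity
  R′ zero    = R zero
  R′ (suc i) = lowerOp K′ (R ∘ suc) i
  split : ∀ i c → rows (suc n) (lowerOp K R) i c ≡ addRow₀ (λ i → K (suc (toℕ i)) 0) (rows (suc n) R′) i c
  split zero    c = +-identityʳ (R 0 c)
  split (suc i) c = x⊕yz≡xz⊕y (R (suc (toℕ i)) c) (K (suc (toℕ i)) 0 · R 0 c) _

detℙ-expandColumn₀ : ∀ n (M : Matrix (suc n)) →
  detℙ (suc n) M ≡ ∑[ i < suc n ] (M i zero · detℙ n (λ r c → M (punchIn i r) (suc c)))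
detℙ-expandColumn₀ zero    M = refl
detℙ-expandColumn₀ (suc n) M = cong (M zero zero · detℙ (suc n) (minor zero M) ⊕_) (begin
  ∑[ j < suc n ] (M zero (suc j) · detℙ (suc n) (minor (suc j) M))
    ≡⟨ sum-cong-≗ (λ j → trans (cong (M zero (suc j) ·_) (detℙ-expandColumn₀ n (minor (suc j) M)))
                              (*-distribˡ-sum (M zero (suc j)) (λ i → M (suc i) zero · E i j))) ⟩
  ∑[ j < suc n ] ∑[ i < suc n ] (M zero (suc j) · (M (suc i) zero · E i j))
    ≡⟨ sum-cong-≗ (λ j → sum-cong-≗ (λ i → x·yz≡y·xz (M zero (suc j)) (M (suc i) zero) (E i j))) ⟩
  ∑[ j < suc n ] ∑[ i < suc n ] (M (suc i) zero · (M zero (suc j) · E i j))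
    ≡⟨ ∑-comm (λ j i → M (suc i) zero · (M zero (suc j) · E i j)) ⟩
  ∑[ i < suc n ] ∑[ j < suc n ] (M (suc i) zero · (M zero (suc j) · E i j))
    ≡⟨ sum-cong-≗ (λ i → *-distribˡ-sum (M (suc i) zero) (λ j → M zero (suc j) · E i j)) ⟨
  ∑[ i < suc n ] (M (suc i) zero · ∑[ j < suc n ] (M zero (suc j) · E i j)) ∎)
  where
  E : Fin (suc n) → Fin (suc n) → Parity
  E i j = detℙ n (λ r c → M (suc (punchIn i r)) (suc (punchIn j c)))

detℙ-transpose : ∀ n (M : Matrix n) → detℙ n (λ i j → M j i) ≡ detℙ n M
detℙ-transpose zero    M = refl
detℙ-transpose (suc n) M = trans
  (sum-cong-≗ (λ j → cong (M j zero ·_) (detℙ-transpose n (λ r c → M (punchIn j r) (suc c)))))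
  (sym (detℙ-expandColumn₀ n M))

detℙ-zeroRow₀ : ∀ n (M : Matrix (suc n)) → (∀ j → M zero j ≡ 0ℙ) → detℙ (suc n) M ≡ 0ℙ
detℙ-zeroRow₀ n M row₀ = trans
  (sum-cong-≗ (λ j → cong (_· detℙ n (minor j M)) (row₀ j)))
  (sum-replicate-zero (suc n))

-- Formal power series over 𝔽₂

Series : Set
Series = ℕ → Parity

infixl 6 _⊞_
infixl 7 _⊛_
infixr 8 x·_ x²·_

_⊞_ : Series → Series → Series
(a ⊞ b) m = a m ⊕ b m

X^_ : ℕ → Series
(X^ zero)  zero    = 1ℙ
(X^ zero)  (suc m) = 0ℙ
(X^ suc k) zero    = 0ℙ
(X^ suc k) (suc m) = (X^ k) m

x·_ : Series → Series
(x· a) zero    = 0ℙ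
(x· a) (suc m) = a m

x²·_ : Series → Series
x²· a = x· x· a

scale : Parity → Series → Series
scale p a m = p · a m

_⊛_ : Series → Series → Series
(a ⊛ b) m = ∑ℕ (suc m) (λ t → a t · b (m ∸ t))

⊞-cong : ∀ {a a′ b b′} → a ≗ a′ → b ≗ b′ → a ⊞ b ≗ a′ ⊞ b′
⊞-cong a≗a′ b≗b′ m = cong₂ _⊕_ (a≗a′ m) (b≗b′ m)

x²·-cong : ∀ {a b} → a ≗ b → x²· a ≗ x²· b
x²·-cong a≗b zero          = refl
x²·-cong a≗b (suc zero)    = refl
x²·-cong a≗b (suc (suc m)) = a≗b m

x²·-distrib-⊞ : ∀ a b → x²· (a ⊞ b) ≗ x²· a ⊞ x²· b
x²·-distrib-⊞ a b zero          = refl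
x²·-distrib-⊞ a b (suc zero)    = refl
x²·-distrib-⊞ a b (suc (suc m)) = refl

x²·-cancel : ∀ {a b} → x²· a ≗ x²· b → a ≗ b
x²·-cancel eq m = eq (suc (suc m))

⊛-cong : ∀ {a a′ b b′} → a ≗ a′ → b ≗ b′ → a ⊛ b ≗ a′ ⊛ b′
⊛-cong a≗a′ b≗b′ m = ∑ℕ-cong (suc m) (λ t _ → cong₂ _·_ (a≗a′ t) (b≗b′ (m ∸ t)))

⊛-distribʳ-⊞ : ∀ a b c → (a ⊞ b) ⊛ c ≗ a ⊛ c ⊞ b ⊛ c
⊛-distribʳ-⊞ a b c m = trans
  (∑ℕ-cong (suc m) (λ t _ → *-distribʳ-+ (c (m ∸ t)) (a t) (b t)))
  (∑-distrib-+ {suc m} (λ t → a (toℕ t) · c (m ∸ toℕ t)) (λ t → b (toℕ t) · c (m ∸ toℕ t)))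

⊛-distribˡ-⊞ : ∀ a b c → a ⊛ (b ⊞ c) ≗ a ⊛ b ⊞ a ⊛ c
⊛-distribˡ-⊞ a b c m = trans
  (∑ℕ-cong (suc m) (λ t _ → *-distribˡ-+ (a t) (b (m ∸ t)) (c (m ∸ t))))
  (∑-distrib-+ {suc m} (λ t → a (toℕ t) · b (m ∸ toℕ t)) (λ t → a (toℕ t) · c (m ∸ toℕ t)))

⊛-scaleˡ : ∀ p a b → scale p a ⊛ b ≗ scale p (a ⊛ b)
⊛-scaleˡ p a b m = trans
  (∑ℕ-cong (suc m) (λ t _ → *-assoc p (a t) (b (m ∸ t))))
  (sym (*-distribˡ-sum {suc m} p (λ t → a (toℕ t) · b (m ∸ toℕ t))))

⊛-x·ˡ : ∀ a b → (x· a) ⊛ b ≗ x· (a ⊛ b)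
⊛-x·ˡ a b zero    = refl
⊛-x·ˡ a b (suc m) = refl

⊛-identityˡ : ∀ b → X^ 0 ⊛ b ≗ b
⊛-identityˡ b m = trans (cong (b m ⊕_) (∑ℕ-vanish m (λ _ → 0ℙ) (λ _ _ → refl))) (+-identityʳ (b m))

⊛-unfoldˡ : ∀ a b → a ⊛ b ≗ scale (a 0) b ⊞ x· ((a ∘ suc) ⊛ b)
⊛-unfoldˡ a b zero    = refl
⊛-unfoldˡ a b (suc m) = refl

⊛-comm : ∀ a b → a ⊛ b ≗ b ⊛ a
⊛-comm a b zero          = cong (_⊕ 0ℙ) (*-comm (a 0) (b 0))
⊛-comm a b (suc zero)    = begin
  a 0 · b 1 ⊕ (a 1 · b 0 ⊕ 0ℙ)
    ≡⟨ cong₂ (λ x y → x ⊕ (y ⊕ 0ℙ)) (*-comm (a 0) (b 1)) (*-comm (a 1) (b 0)) ⟩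
  b 1 · a 0 ⊕ (b 0 · a 1 ⊕ 0ℙ)
    ≡⟨ x⊕yz≡y⊕xz (b 1 · a 0) (b 0 · a 1) 0ℙ ⟩
  b 0 · a 1 ⊕ (b 1 · a 0 ⊕ 0ℙ) ∎
⊛-comm a b (suc (suc m)) = begin
  A ⊕ ((a ∘ suc) ⊛ b) (suc m)          ≡⟨ cong (A ⊕_) (⊛-comm (a ∘ suc) b (suc m)) ⟩
  A ⊕ (B ⊕ ((b ∘ suc) ⊛ (a ∘ suc)) m)  ≡⟨ cong (λ x → A ⊕ (B ⊕ x)) (⊛-comm (b ∘ suc) (a ∘ suc) m) ⟩
  A ⊕ (B ⊕ ((a ∘ suc) ⊛ (b ∘ suc)) m)  ≡⟨ x⊕yz≡y⊕xz A B _ ⟩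
  B ⊕ (A ⊕ ((a ∘ suc) ⊛ (b ∘ suc)) m)  ≡⟨ cong (B ⊕_) (⊛-comm a (b ∘ suc) (suc m)) ⟩
  B ⊕ ((b ∘ suc) ⊛ a) (suc m)          ∎
  where
  A = a 0 · b (suc (suc m))
  B = b 0 · a (suc (suc m))

⊛-assoc : ∀ a b c → (a ⊛ b) ⊛ c ≗ a ⊛ (b ⊛ c)
⊛-assoc a b c m = begin
  ((a ⊛ b) ⊛ c) m
    ≡⟨ ⊛-cong {b = c} (⊛-unfoldˡ a b) (λ _ → refl) m ⟩
  ((scale (a 0) b ⊞ x· ((a ∘ suc) ⊛ b)) ⊛ c) m
    ≡⟨ ⊛-distribʳ-⊞ (scale (a 0) b) (x· ((a ∘ suc) ⊛ b)) c m ⟩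
  (scale (a 0) b ⊛ c) m ⊕ (x· ((a ∘ suc) ⊛ b) ⊛ c) m
    ≡⟨ cong₂ _⊕_ (⊛-scaleˡ (a 0) b c m) (⊛-x·ˡ ((a ∘ suc) ⊛ b) c m) ⟩
  scale (a 0) (b ⊛ c) m ⊕ (x· (((a ∘ suc) ⊛ b) ⊛ c)) m
    ≡⟨ cong (scale (a 0) (b ⊛ c) m ⊕_) (shifted m) ⟩
  scale (a 0) (b ⊛ c) m ⊕ (x· ((a ∘ suc) ⊛ (b ⊛ c))) m
    ≡⟨ ⊛-unfoldˡ a (b ⊛ c) m ⟨
  (a ⊛ (b ⊛ c)) m ∎
  where
  shifted : x· (((a ∘ suc) ⊛ b) ⊛ c) ≗ x· ((a ∘ suc) ⊛ (b ⊛ c))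
  shifted zero    = refl
  shifted (suc m) = ⊛-assoc (a ∘ suc) b c m

⊛-identityʳ : ∀ a → a ⊛ X^ 0 ≗ a
⊛-identityʳ a m = trans (⊛-comm a (X^ 0) m) (⊛-identityˡ a m)

⊛-x²·ˡ : ∀ a b → (x²· a) ⊛ b ≗ x²· (a ⊛ b)
⊛-x²·ˡ a b zero          = refl
⊛-x²·ˡ a b (suc zero)    = refl
⊛-x²·ˡ a b (suc (suc m)) = refl

⊛-x²·ʳ : ∀ a b → a ⊛ (x²· b) ≗ x²· (a ⊛ b)
⊛-x²·ʳ a b m = trans (⊛-comm a (x²· b) m) (trans (⊛-x²·ˡ b a m) (x²·-cong (⊛-comm b a) m))

⊞-assoc : ∀ a b c → (a ⊞ b) ⊞ c ≗ a ⊞ (b ⊞ c)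
⊞-assoc a b c m = +-assoc (a m) (b m) (c m)

infixr 8 1+x²·_

1+x²·_ : Series → Series
1+x²· G = X^ 0 ⊞ x²· G

⊛-1+x²·ʳ : ∀ b c → b ⊛ 1+x²· c ≗ b ⊞ x²· (b ⊛ c)
⊛-1+x²·ʳ b c m = trans (⊛-distribˡ-⊞ b (X^ 0) (x²· c) m) (cong₂ _⊕_ (⊛-identityʳ b m) (⊛-x²·ʳ b c m))

⊛-[1+x²]ˡ : ∀ b c → (b ⊞ x²· b) ⊛ c ≗ b ⊛ c ⊞ x²· (b ⊛ c)
⊛-[1+x²]ˡ b c m = trans (⊛-distribʳ-⊞ b (x²· b) c m) (cong ((b ⊛ c) m ⊕_) (⊛-x²·ˡ b c m))

X^-< : ∀ {k t} → t < k → (X^ k) t ≡ 0ℙ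
X^-< {suc k} {zero}  _         = refl
X^-< {suc k} {suc t} (s≤s t<k) = X^-< t<k

X^-diagonal : ∀ k → (X^ k) k ≡ 1ℙ
X^-diagonal zero    = refl
X^-diagonal (suc k) = X^-diagonal k

X^-above : ∀ k y → (X^ k) (suc k + y) ≡ 0ℙ
X^-above zero    y = refl
X^-above (suc k) y = X^-above k y

-- F(0) = x^k(0); when k > 0 this vanishes, and then (F / x) P = x^(k-1).
⊛≗X^⇒initial : ∀ k F P → P 0 ≡ 1ℙ → F ⊛ P ≗ X^ k → ∀ t → t ≤ k → F t ≡ (X^ k) t
⊛≗X^⇒initial k F P P₀ FP≗X^k zero _ = begin
  F 0             ≡⟨ *-identityʳ (F 0) ⟨
  F 0 · 1ℙ        ≡⟨ cong (F 0 ·_) P₀ ⟨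
  F 0 · P 0       ≡⟨ +-identityʳ (F 0 · P 0) ⟨
  (F ⊛ P) 0       ≡⟨ FP≗X^k 0 ⟩
  (X^ k) 0        ∎
⊛≗X^⇒initial (suc k) F P P₀ FP≗X^k (suc t) (s≤s t≤k) =
  ⊛≗X^⇒initial k (F ∘ suc) P P₀ shifted t t≤k
  where
  F₀≡0 : F 0 ≡ 0ℙ
  F₀≡0 = ⊛≗X^⇒initial (suc k) F P P₀ FP≗X^k 0 z≤n
  shifted : (F ∘ suc) ⊛ P ≗ X^ k
  shifted m = trans (cong (λ x → x · P (suc m) ⊕ ((F ∘ suc) ⊛ P) m) (sym F₀≡0)) (FP≗X^k (suc m))

infixl 9 _∘x²

_∘x² : Series → Series
(g ∘x²) zero          = g 0
(g ∘x²) (suc zero)    = 0ℙ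
(g ∘x²) (suc (suc m)) = ((g ∘ suc) ∘x²) m

data EvenOdd : ℕ → Set where
  even : ∀ j → EvenOdd (j + j)
  odd  : ∀ j → EvenOdd (suc (j + j))

evenOdd : ∀ n → EvenOdd n
evenOdd zero    = even 0
evenOdd (suc n) with evenOdd n
... | even j = odd j
... | odd j  = subst EvenOdd (cong suc (+-suc j j)) (even (suc j))

∘x²-even : ∀ g j → (g ∘x²) (j + j) ≡ g j
∘x²-even g zero    = refl
∘x²-even g (suc j) = trans (cong (λ x → (g ∘x²) (suc x)) (+-suc j j)) (∘x²-even (g ∘ suc) j)

∘x²-odd : ∀ g j → (g ∘x²) (suc (j + j)) ≡ 0ℙ
∘x²-odd g zero    = refl
∘x²-odd g (suc j) = trans (cong (λ x → (g ∘x²) (2 + x)) (+-suc j j)) (∘x²-odd (g ∘ suc) j)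

-- The cross terms g_s g_t and g_t g_s (s ≠ t) cancel in characteristic 2.
⊛-self≗∘x² : ∀ g → g ⊛ g ≗ g ∘x²
⊛-self≗∘x² g zero    = trans (+-identityʳ (g 0 · g 0)) (*-idem (g 0))
⊛-self≗∘x² g (suc m) = begin
  p ⊕ ((g ∘ suc) ⊛ g) m  ≡⟨ cong (p ⊕_) (trans (⊛-comm (g ∘ suc) g m) (⊛-unfoldˡ g (g ∘ suc) m)) ⟩
  p ⊕ (p ⊕ q)            ≡⟨ +-assoc p p q ⟨
  (p ⊕ p) ⊕ q            ≡⟨ cong (_⊕ q) (p+p≡0ℙ p) ⟩
  q                      ≡⟨ shifted m ⟩
  (g ∘x²) (suc m)        ∎
  where
  p = g 0 · g (suc m)
  q = (x· ((g ∘ suc) ⊛ (g ∘ suc))) m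
  shifted : ∀ m → (x· ((g ∘ suc) ⊛ (g ∘ suc))) m ≡ (g ∘x²) (suc m)
  shifted zero    = refl
  shifted (suc m) = ⊛-self≗∘x² (g ∘ suc) m

-- Hankel determinants over 𝔽₂

detℕ : ℕ → (ℕ → ℕ → Parity) → Parity
detℕ n A = detℙ n (λ i j → A (toℕ i) (toℕ j))

detℕ-lowerOp : ∀ n K (A : ℕ → ℕ → Parity) → detℕ n (lowerOp K A) ≡ detℕ n A
detℕ-lowerOp n K A = detℙ-lowerOp n K (λ i c → A i (toℕ c))

detℕ-transpose : ∀ n (A : ℕ → ℕ → Parity) → detℕ n (λ i j → A j i) ≡ detℕ n A
detℕ-transpose n A = detℙ-transpose n (λ i j → A (toℕ i) (toℕ j))

hankel : Series → ℕ → ℕ → Parity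
hankel F i j = F (i + j)

Hℙ : ℕ → Series → Parity
Hℙ n F = detℕ n (hankel F)

drop : ℕ → Series → Series
drop k P x = P (k + x)

Hℙ-vanishing : ∀ n G → (∀ t → t < suc n → G t ≡ 0ℙ) → Hℙ (suc n) G ≡ 0ℙ
Hℙ-vanishing n G G≡0 = detℙ-zeroRow₀ n (λ i j → G (toℕ i + toℕ j)) (λ j → G≡0 (toℕ j) (toℕ<n j))

∑-unit : ∀ n (j : Fin n) (g : Fin n → Parity) → ∑[ c < n ] ((X^ toℕ j) (toℕ c) · g c) ≡ g j
∑-unit (suc n) zero    g = trans (cong (g zero ⊕_) (sum-replicate-zero n)) (+-identityʳ (g zero))
∑-unit (suc n) (suc j) g = ∑-unit n j (g ∘ suc)

detℙ-unitRow₀ : ∀ n (j : Fin (suc n)) (M : Matrix (suc n)) →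
  (∀ c → M zero c ≡ (X^ toℕ j) (toℕ c)) → detℙ (suc n) M ≡ detℙ n (minor j M)
detℙ-unitRow₀ n j M row₀ = trans
  (sum-cong-≗ (λ c → cong (_· detℙ n (minor c M)) (row₀ c)))
  (∑-unit (suc n) j (λ c → detℙ n (minor c M)))

-- Row operations with the unitriangular Toeplitz matrix of P clear the first k + 1 rows of
-- the Hankel matrix of F down to an antidiagonal, leaving the Hankel matrix of P / x^(k+2)
-- up to a further unitriangular transformation.
module HankelReduction (F P : Series) (k : ℕ) (P₀ : P 0 ≡ 1ℙ) (FP≗X^k : F ⊛ P ≗ X^ k) where

  F-below : ∀ t → t < k → F t ≡ 0ℙ
  F-below t t<k = trans (⊛≗X^⇒initial k F P P₀ FP≗X^k t (<⇒≤ t<k)) (X^-< t<k)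

  F-k : F k ≡ 1ℙ
  F-k = trans (⊛≗X^⇒initial k F P P₀ FP≗X^k k ≤-refl) (X^-diagonal k)

  -- Since F P = x^k, C i c = Σ_{i ≤ t ≤ i+c} F_t P_(i+c−t).
  C : ℕ → ℕ → Parity
  C i c = (X^ k) (i + c) ⊕ ∑ℕ i (λ t → F t · P (i + c ∸ t))

  X^k-split : ∀ i c → (X^ k) (i + c) ≡
    ∑ℕ i (λ t → F t · P (i + c ∸ t)) ⊕ (∑ℕ c (λ s → F (i + s) · P (c ∸ s)) ⊕ F (i + c))
  X^k-split i c = begin
    (X^ k) (i + c)
      ≡⟨ FP≗X^k (i + c) ⟨
    ∑ℕ (suc (i + c)) h
      ≡⟨ cong (λ n → ∑ℕ n h) (+-suc i c) ⟨
    ∑ℕ (i + suc c) h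
      ≡⟨ ∑ℕ-+ i (suc c) h ⟩
    ∑ℕ i h ⊕ ∑ℕ (suc c) (λ s → h (i + s))
      ≡⟨ cong (∑ℕ i h ⊕_) (∑ℕ-suc c (λ s → h (i + s))) ⟩
    ∑ℕ i h ⊕ (∑ℕ c (λ s → h (i + s)) ⊕ h (i + c))
      ≡⟨ cong₂ (λ x y → ∑ℕ i h ⊕ (x ⊕ y)) tail-sum last-term ⟩
    ∑ℕ i h ⊕ (∑ℕ c (λ s → F (i + s) · P (c ∸ s)) ⊕ F (i + c)) ∎
    where
    h = λ t → F t · P (i + c ∸ t)
    tail-sum : ∑ℕ c (λ s → h (i + s)) ≡ ∑ℕ c (λ s → F (i + s) · P (c ∸ s))
    tail-sum = ∑ℕ-cong c (λ s _ → cong (λ x → F (i + s) · P x) ([m+n]∸[m+o]≡n∸o i c s))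
    last-term : h (i + c) ≡ F (i + c)
    last-term = trans (cong (λ x → F (i + c) · P x) (n∸n≡0 (i + c)))
                      (trans (cong (F (i + c) ·_) P₀) (*-identityʳ (F (i + c))))

  lowerOp-hankel : ∀ i c → lowerOp (λ i s → P (i ∸ s)) (hankel F) c i ≡ C i c
  lowerOp-hankel i c = begin
    F (c + i) ⊕ ∑ℕ c (λ s → P (c ∸ s) · F (s + i)) ≡⟨ cong₂ _⊕_ (cong F (+ℕ-comm c i)) reorder ⟩
    Z ⊕ X                                          ≡⟨ +-comm Z X ⟩
    X ⊕ Z                                          ≡⟨ xyx⁻¹≈y Y (X ⊕ Z) ⟨
    Y ⊕ (X ⊕ Z) ⊕ Y                                ≡⟨ cong (_⊕ Y) (X^k-split i c) ⟨
    C i c                                          ∎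
    where
    Y = ∑ℕ i (λ t → F t · P (i + c ∸ t))
    X = ∑ℕ c (λ s → F (i + s) · P (c ∸ s))
    Z = F (i + c)
    reorder : ∑ℕ c (λ s → P (c ∸ s) · F (s + i)) ≡ X
    reorder = ∑ℕ-cong c (λ s _ →
      trans (*-comm (P (c ∸ s)) (F (s + i))) (cong (λ x → F x · P (c ∸ s)) (+ℕ-comm s i)))

  Hℙ≡detℕ-C : ∀ N → Hℙ N F ≡ detℕ N C
  Hℙ≡detℕ-C N = begin
    detℕ N (hankel F)
      ≡⟨ detℕ-lowerOp N (λ i s → P (i ∸ s)) (hankel F) ⟨
    detℕ N (lowerOp (λ i s → P (i ∸ s)) (hankel F))
      ≡⟨ detℕ-transpose N (lowerOp (λ i s → P (i ∸ s)) (hankel F)) ⟨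
    detℕ N (λ i c → lowerOp (λ i s → P (i ∸ s)) (hankel F) c i)
      ≡⟨ detℙ-cong N (λ i c → lowerOp-hankel (toℕ i) (toℕ c)) ⟩
    detℕ N C ∎

  C-top : ∀ i c → i ≤ k → C i c ≡ (X^ k) (i + c)
  C-top i c i≤k = trans (cong ((X^ k) (i + c) ⊕_) (∑ℕ-vanish i _ F-below-i)) (+-identityʳ _)
    where
    F-below-i : ∀ t → t < i → F t · P (i + c ∸ t) ≡ 0ℙ
    F-below-i t t<i = cong (_· P (i + c ∸ t)) (F-below t (<-≤-trans t<i i≤k))

  C-bottom : ∀ i c → C (suc k + i) (suc k + c) ≡ lowerOp (λ i s → F (k + (i ∸ s))) (hankel (drop (2 + k) P)) i c
  C-bottom i c = cong₂ _⊕_ beyond-k (trans split-at-k (cong₂ _⊕_ first-term reversed))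
    where
    G = drop (2 + k) P
    L = (suc k + i) + (suc k + c)
    h = λ t → F t · P (L ∸ t)
    g = λ s → F (k + s) · G ((i ∸ s) + c)
    beyond-k : (X^ k) L ≡ 0ℙ
    beyond-k = trans (cong (X^ k) (cong suc (+ℕ-assoc k i (suc k + c)))) (X^-above k (i + (suc k + c)))
    regroup : ∀ k c s d → (suc k + (s + d)) + (suc k + c) ≡ (k + s) + (2 + k + (d + c))
    regroup = solve-∀
    index : ∀ s → s < suc i → L ∸ (k + s) ≡ 2 + k + ((i ∸ s) + c)
    index s s≤i = begin
      L ∸ (k + s)
        ≡⟨ cong (λ x → (suc k + x) + (suc k + c) ∸ (k + s)) (m+[n∸m]≡n (s≤s⁻¹ s≤i)) ⟨
      (suc k + (s + (i ∸ s))) + (suc k + c) ∸ (k + s)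
        ≡⟨ cong (_∸ (k + s)) (regroup k c s (i ∸ s)) ⟩
      (k + s) + (2 + k + ((i ∸ s) + c)) ∸ (k + s)
        ≡⟨ m+n∸m≡n (k + s) _ ⟩
      2 + k + ((i ∸ s) + c) ∎
    split-at-k : ∑ℕ (suc k + i) h ≡ ∑ℕ (suc i) g
    split-at-k = begin
      ∑ℕ (suc k + i) h                       ≡⟨ cong (λ n → ∑ℕ n h) (+-suc k i) ⟨
      ∑ℕ (k + suc i) h                       ≡⟨ ∑ℕ-+ k (suc i) h ⟩
      ∑ℕ k h ⊕ ∑ℕ (suc i) (λ s → h (k + s))  ≡⟨ cong₂ _⊕_ (∑ℕ-vanish k h (λ t t<k → cong (_· P (L ∸ t)) (F-below t t<k)))
                                                           (∑ℕ-cong (suc i) (λ s s≤i → cong (F (k + s) ·_) (cong P (index s s≤i)))) ⟩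
      ∑ℕ (suc i) g                           ∎
    first-term : g 0 ≡ G (i + c)
    first-term = trans (cong (λ x → F x · G (i + c)) (+ℕ-identityʳ k)) (cong (_· G (i + c)) F-k)
    reversed : ∑ℕ i (g ∘ suc) ≡ ∑ℕ i (λ s → F (k + (i ∸ s)) · G (s + c))
    reversed = trans
      (∑ℕ-cong i (λ s s<i → cong (λ x → F (k + x) · G ((i ∸ suc s) + c)) (sym (m∸[m∸n]≡n s<i))))
      (∑ℕ-reverse i (λ s → F (k + (i ∸ s)) · G (s + c)))

  Hℙ-bottom : ∀ n → detℕ n (λ i c → C (suc k + i) (suc k + c)) ≡ Hℙ n (drop (2 + k) P)
  Hℙ-bottom n = trans (detℙ-cong n (λ i c → C-bottom (toℕ i) (toℕ c)))
                      (detℕ-lowerOp n (λ i s → F (k + (i ∸ s))) (hankel (drop (2 + k) P)))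

hankel-reduction₀ : ∀ F G → F ⊛ 1+x²· G ≗ X^ 0 → ∀ n → Hℙ (suc n) F ≡ Hℙ n G
hankel-reduction₀ F G F[1+x²G]≗1 n = begin
  Hℙ (suc n) F
    ≡⟨ Hℙ≡detℕ-C (suc n) ⟩
  detℕ (suc n) C
    ≡⟨ detℙ-unitRow₀ n zero (λ i j → C (toℕ i) (toℕ j)) (λ c → C-top 0 (toℕ c) z≤n) ⟩
  detℕ n (λ i c → C (suc i) (suc c))
    ≡⟨ Hℙ-bottom n ⟩
  Hℙ n G ∎
  where open HankelReduction F (1+x²· G) 0 refl F[1+x²G]≗1

hankel-reduction₂ : ∀ F G → F ⊛ 1+x²· G ≗ X^ 2 → ∀ n → Hℙ (3 + n) F ≡ Hℙ n (drop 2 G)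
hankel-reduction₂ F G F[1+x²G]≗x² n = begin
  Hℙ (3 + n) F                           ≡⟨ Hℙ≡detℕ-C (3 + n) ⟩
  detℙ (3 + n) M                         ≡⟨ detℙ-unitRow₀ (2 + n) two M (λ c → C-top 0 (toℕ c) z≤n) ⟩
  detℙ (2 + n) (minor two M)             ≡⟨ detℙ-unitRow₀ (1 + n) one (minor two M) row₁ ⟩
  detℙ (1 + n) (minor one (minor two M)) ≡⟨ detℙ-unitRow₀ n zero (minor one (minor two M)) row₂ ⟩
  detℕ n (λ i c → C (3 + i) (3 + c))     ≡⟨ Hℙ-bottom n ⟩
  Hℙ n (drop 2 G)                        ∎
  where
  open HankelReduction F (1+x²· G) 2 refl F[1+x²G]≗x²
  M : Matrix (3 + n)
  M i j = C (toℕ i) (toℕ j)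
  one : Fin (2 + n)
  one = suc zero
  two : Fin (3 + n)
  two = suc (suc zero)
  row₁ : ∀ c → C 1 (toℕ (punchIn two c)) ≡ (X^ 1) (toℕ c)
  row₁ zero          = C-top 1 0 (s≤s z≤n)
  row₁ (suc zero)    = C-top 1 1 (s≤s z≤n)
  row₁ (suc (suc c)) = C-top 1 (3 + toℕ c) (s≤s z≤n)
  row₂ : ∀ c → C 2 (toℕ (punchIn two (punchIn one c))) ≡ (X^ 0) (toℕ c)
  row₂ zero    = C-top 2 0 (s≤s (s≤s z≤n))
  row₂ (suc c) = C-top 2 (3 + toℕ c) (s≤s (s≤s z≤n))

-- A continued fraction of period six

-- The hypotheses characterise the reduction of f mod 2. For g = x² a they give
-- g + g(x²) = x²/(1 + x²), which Frobenius turns into g + g² = x²/(1 + x²).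
module PeriodSix (a : Series) (a₀ : a 0 ≡ 1ℙ) (a-odd : ∀ j → a (suc (j + j)) ≡ 0ℙ)
                 (a-even : ∀ j → a (2 + (j + j)) ≡ 1ℙ ⊕ a j) where

  positives : Series
  positives zero    = 0ℙ
  positives (suc _) = 1ℙ

  evens : Series
  evens = positives ∘x²

  evens-[1+x²] : evens ⊞ x²· evens ≗ x²· X^ 0
  evens-[1+x²] zero                      = refl
  evens-[1+x²] (suc zero)                = refl
  evens-[1+x²] (suc (suc zero))          = refl
  evens-[1+x²] (suc (suc (suc zero)))    = refl
  evens-[1+x²] (suc (suc (suc (suc m)))) = p+p≡0ℙ (evens (suc (suc m)))

  x²a : Series
  x²a = x²· a

  x²a-even : ∀ j → x²a (j + j) ⊕ x²a j ≡ positives j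
  x²a-even zero          = refl
  x²a-even (suc zero)    = cong (_⊕ 0ℙ) a₀
  x²a-even (suc (suc j)) = begin
    a (j + suc (suc j)) ⊕ a j
      ≡⟨ cong (λ x → a x ⊕ a j) (trans (+-suc j (suc j)) (cong suc (+-suc j j))) ⟩
    a (2 + (j + j)) ⊕ a j
      ≡⟨ cong (_⊕ a j) (a-even j) ⟩
    (1ℙ ⊕ a j) ⊕ a j
      ≡⟨ p⁻¹+p≡1ℙ (a j) ⟩
    1ℙ ∎

  x²a-odd : ∀ j → x²a (suc (j + j)) ≡ 0ℙ
  x²a-odd zero    = refl
  x²a-odd (suc j) = trans (cong a (+-suc j j)) (a-odd j)

  x²a-⊞-∘x² : x²a ⊞ x²a ∘x² ≗ evens
  x²a-⊞-∘x² m with evenOdd m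
  ... | even j = trans (cong (x²a (j + j) ⊕_) (∘x²-even x²a j))
                       (trans (x²a-even j) (sym (∘x²-even positives j)))
  ... | odd j  = trans (cong (x²a (suc (j + j)) ⊕_) (∘x²-odd x²a j))
                       (trans (+-identityʳ _) (trans (x²a-odd j) (sym (∘x²-odd positives j))))

  G₃ : Series
  G₃ = a ⊞ x²· a

  G₁ : Series
  G₁ = X^ 0 ⊞ G₃

  G₂ : Series
  G₂ = drop 2 G₃

  G₃-inverse : G₃ ⊛ 1+x²· a ≗ X^ 0
  G₃-inverse = x²·-cancel λ m → begin
    (x²· (G₃ ⊛ 1+x²· a)) m
      ≡⟨ ⊛-x²·ˡ G₃ (1+x²· a) m ⟨
    (x²· G₃ ⊛ 1+x²· a) m
      ≡⟨ ⊛-cong {b = 1+x²· a} (x²·-distrib-⊞ a (x²· a)) (λ _ → refl) m ⟩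
    ((x²a ⊞ x²· x²a) ⊛ 1+x²· a) m
      ≡⟨ ⊛-[1+x²]ˡ x²a (1+x²· a) m ⟩
    (x²a ⊛ 1+x²· a ⊞ x²· (x²a ⊛ 1+x²· a)) m
      ≡⟨ ⊞-cong quadratic (x²·-cong quadratic) m ⟩
    (evens ⊞ x²· evens) m
      ≡⟨ evens-[1+x²] m ⟩
    (x²· X^ 0) m ∎
    where
    quadratic : x²a ⊛ 1+x²· a ≗ evens
    quadratic m = begin
      (x²a ⊛ (X^ 0 ⊞ x²a)) m      ≡⟨ ⊛-distribˡ-⊞ x²a (X^ 0) x²a m ⟩
      (x²a ⊛ X^ 0 ⊞ x²a ⊛ x²a) m  ≡⟨ ⊞-cong (⊛-identityʳ x²a) (⊛-self≗∘x² x²a) m ⟩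
      (x²a ⊞ x²a ∘x²) m           ≡⟨ x²a-⊞-∘x² m ⟩
      evens m                     ∎

  a-inverse : a ⊛ 1+x²· G₁ ≗ X^ 0
  a-inverse m = begin
    (a ⊛ 1+x²· G₁) m                  ≡⟨ ⊛-1+x²·ʳ a G₁ m ⟩
    (a ⊞ x²· (a ⊛ G₁)) m              ≡⟨ cong (a m ⊕_) (x²·-cong a⊛G₁ m) ⟩
    (a ⊞ x²· (a ⊞ a ⊛ G₃)) m          ≡⟨ cong (a m ⊕_) (x²·-distrib-⊞ a (a ⊛ G₃) m) ⟩
    (a ⊞ (x²· a ⊞ x²· (a ⊛ G₃))) m    ≡⟨ ⊞-assoc a (x²· a) (x²· (a ⊛ G₃)) m ⟨
    (G₃ ⊞ x²· (a ⊛ G₃)) m             ≡⟨ cong (G₃ m ⊕_) (x²·-cong (⊛-comm a G₃) m) ⟩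
    (G₃ ⊞ x²· (G₃ ⊛ a)) m             ≡⟨ ⊛-1+x²·ʳ G₃ a m ⟨
    (G₃ ⊛ 1+x²· a) m                  ≡⟨ G₃-inverse m ⟩
    (X^ 0) m                          ∎
    where
    a⊛G₁ : a ⊛ G₁ ≗ a ⊞ a ⊛ G₃
    a⊛G₁ m = trans (⊛-distribˡ-⊞ a (X^ 0) G₃ m) (cong (_⊕ (a ⊛ G₃) m) (⊛-identityʳ a m))

  -- Since G₃ G₃ = (1 + x²) a G₃: (1 + G₃)(1 + x² G₃) = 1 + (1 + x²) G₃ (1 + x² a) = x².
  G₁⊛1+x²·G₃≗x² : G₁ ⊛ 1+x²· G₃ ≗ X^ 2
  G₁⊛1+x²·G₃≗x² m = begin
    (G₁ ⊛ 1+x²· G₃) m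
      ≡⟨ ⊛-distribʳ-⊞ (X^ 0) G₃ (1+x²· G₃) m ⟩
    (X^ 0 ⊛ 1+x²· G₃ ⊞ G₃ ⊛ 1+x²· G₃) m
      ≡⟨ ⊞-cong (⊛-identityˡ (1+x²· G₃)) (⊛-1+x²·ʳ G₃ G₃) m ⟩
    (1+x²· G₃ ⊞ (G₃ ⊞ x²· (G₃ ⊛ G₃))) m
      ≡⟨ ⊞-assoc (X^ 0) (x²· G₃) (G₃ ⊞ x²· (G₃ ⊛ G₃)) m ⟩
    (X^ 0) m ⊕ (x²· G₃ ⊞ (G₃ ⊞ x²· (G₃ ⊛ G₃))) m
      ≡⟨ cong ((X^ 0) m ⊕_) (regroup m) ⟩
    (X^ 0) m ⊕ (W ⊞ x²· W) m
      ≡⟨ cong ((X^ 0) m ⊕_) (⊞-cong W≗1 (x²·-cong W≗1) m) ⟩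
    (X^ 0 ⊞ (X^ 0 ⊞ x²· X^ 0)) m
      ≡⟨ 1+1+x² m ⟩
    (X^ 2) m ∎
    where
    V = a ⊛ G₃
    W = G₃ ⊞ x²· V
    W≗1 : W ≗ X^ 0
    W≗1 m = trans (cong (G₃ m ⊕_) (x²·-cong (⊛-comm a G₃) m)) (trans (sym (⊛-1+x²·ʳ G₃ a m)) (G₃-inverse m))
    regroup : x²· G₃ ⊞ (G₃ ⊞ x²· (G₃ ⊛ G₃)) ≗ W ⊞ x²· W
    regroup m = begin
      (x²· G₃) m ⊕ (G₃ m ⊕ (x²· (G₃ ⊛ G₃)) m)
        ≡⟨ cong (λ x → (x²· G₃) m ⊕ (G₃ m ⊕ x)) (trans (x²·-cong (⊛-[1+x²]ˡ a G₃) m)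
                                                       (x²·-distrib-⊞ V (x²· V) m)) ⟩
      (x²· G₃) m ⊕ (G₃ m ⊕ ((x²· V) m ⊕ (x²· x²· V) m))
        ≡⟨ x⊕yz≡y⊕xz ((x²· G₃) m) (G₃ m) _ ⟩
      G₃ m ⊕ ((x²· G₃) m ⊕ ((x²· V) m ⊕ (x²· x²· V) m))
        ≡⟨ cong (G₃ m ⊕_) (x⊕yz≡y⊕xz ((x²· G₃) m) ((x²· V) m) _) ⟩
      G₃ m ⊕ ((x²· V) m ⊕ ((x²· G₃) m ⊕ (x²· x²· V) m))
        ≡⟨ +-assoc (G₃ m) ((x²· V) m) _ ⟨
      W m ⊕ ((x²· G₃) m ⊕ (x²· x²· V) m)
        ≡⟨ cong (W m ⊕_) (x²·-distrib-⊞ G₃ (x²· V) m) ⟨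
      (W ⊞ x²· W) m ∎
    1+1+x² : X^ 0 ⊞ (X^ 0 ⊞ x²· X^ 0) ≗ X^ 2
    1+1+x² zero          = refl
    1+1+x² (suc zero)    = refl
    1+1+x² (suc (suc m)) = refl

  G₁-vanishes : ∀ t → t < 2 → G₁ t ≡ 0ℙ
  G₁-vanishes t t<2 = trans (⊛≗X^⇒initial 2 G₁ (1+x²· G₃) refl G₁⊛1+x²·G₃≗x² t (<⇒≤ t<2)) (X^-< t<2)

  x²·G₂≗G₁ : x²· G₂ ≗ G₁
  x²·G₂≗G₁ zero          = sym (G₁-vanishes 0 (s≤s z≤n))
  x²·G₂≗G₁ (suc zero)    = sym (G₁-vanishes 1 (s≤s (s≤s z≤n)))
  x²·G₂≗G₁ (suc (suc m)) = refl

  G₂-inverse : G₂ ⊛ 1+x²· G₃ ≗ X^ 0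
  G₂-inverse = x²·-cancel λ m → begin
    (x²· (G₂ ⊛ 1+x²· G₃)) m   ≡⟨ ⊛-x²·ˡ G₂ (1+x²· G₃) m ⟨
    (x²· G₂ ⊛ 1+x²· G₃) m     ≡⟨ ⊛-cong {b = 1+x²· G₃} x²·G₂≗G₁ (λ _ → refl) m ⟩
    (G₁ ⊛ 1+x²· G₃) m         ≡⟨ G₁⊛1+x²·G₃≗x² m ⟩
    (X^ 2) m                  ≡⟨ x²≗x²·1 m ⟩
    (x²· X^ 0) m              ∎
    where
    x²≗x²·1 : X^ 2 ≗ x²· X^ 0
    x²≗x²·1 zero          = refl
    x²≗x²·1 (suc zero)    = refl
    x²≗x²·1 (suc (suc m)) = refl

  Hℙ-period : ∀ n → Hℙ (6 + n) a ≡ Hℙ n a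
  Hℙ-period n = begin
    Hℙ (6 + n) a   ≡⟨ hankel-reduction₀ a G₁ a-inverse (5 + n) ⟩
    Hℙ (5 + n) G₁  ≡⟨ hankel-reduction₂ G₁ G₃ G₁⊛1+x²·G₃≗x² (2 + n) ⟩
    Hℙ (2 + n) G₂  ≡⟨ hankel-reduction₀ G₂ G₃ G₂-inverse (1 + n) ⟩
    Hℙ (1 + n) G₃  ≡⟨ hankel-reduction₀ G₃ a G₃-inverse n ⟩
    Hℙ n a         ∎

  Hℙ-period-6m : ∀ m r → Hℙ (6 * m + r) a ≡ Hℙ r a
  Hℙ-period-6m zero    r = refl
  Hℙ-period-6m (suc m) r = begin
    Hℙ (6 * suc m + r) a    ≡⟨ cong (λ n → Hℙ n a) (six-suc m r) ⟩
    Hℙ (6 + (6 * m + r)) a  ≡⟨ Hℙ-period (6 * m + r) ⟩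
    Hℙ (6 * m + r) a        ≡⟨ Hℙ-period-6m m r ⟩
    Hℙ r a                  ∎
    where
    six-suc : ∀ m r → 6 * suc m + r ≡ 6 + (6 * m + r)
    six-suc = solve-∀

  Hℙ₁ : Hℙ 1 a ≡ 1ℙ
  Hℙ₁ = hankel-reduction₀ a G₁ a-inverse 0

  Hℙ₂ : Hℙ 2 a ≡ 0ℙ
  Hℙ₂ = trans (hankel-reduction₀ a G₁ a-inverse 1)
              (Hℙ-vanishing 0 G₁ (λ t t<1 → G₁-vanishes t (m<n⇒m<1+n t<1)))

  Hℙ₃ : Hℙ 3 a ≡ 0ℙ
  Hℙ₃ = trans (hankel-reduction₀ a G₁ a-inverse 2) (Hℙ-vanishing 1 G₁ G₁-vanishes)

  Hℙ₄ : Hℙ 4 a ≡ 1ℙ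
  Hℙ₄ = trans (hankel-reduction₀ a G₁ a-inverse 3) (hankel-reduction₂ G₁ G₃ G₁⊛1+x²·G₃≗x² 0)

  Hℙ₅ : Hℙ 5 a ≡ 1ℙ
  Hℙ₅ = trans (hankel-reduction₀ a G₁ a-inverse 4)
    (trans (hankel-reduction₂ G₁ G₃ G₁⊛1+x²·G₃≗x² 1) (hankel-reduction₀ G₂ G₃ G₂-inverse 0))

-- Reduction modulo 2

parity-suc-suc : ∀ m n → parity (suc m) ⊕ parity (suc n) ≡ parity m ⊕ parity n
parity-suc-suc m n = begin
  parity (suc m) ⊕ parity (suc n)  ≡⟨ +-homo-+ (suc m) (suc n) ⟨
  parity (suc m + suc n)           ≡⟨ cong (parity ∘ suc) (+-suc m n) ⟩
  parity (m + n)                   ≡⟨ +-homo-+ m n ⟩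
  parity m ⊕ parity n              ∎

parity≡0ℙ⇒2∣ : ∀ n → parity n ≡ 0ℙ → 2 ∣ℕ n
parity≡0ℙ⇒2∣ zero          _    = divides 0 refl
parity≡0ℙ⇒2∣ (suc (suc n)) n-even with parity≡0ℙ⇒2∣ n n-even
... | divides q n≡2q = divides (suc q) (cong (λ x → 2 + x) n≡2q)

2∣⇒parity≡0ℙ : ∀ {n} → 2 ∣ℕ n → parity n ≡ 0ℙ
2∣⇒parity≡0ℙ (divides q refl) = trans (*-homo-* q 2) (*-zeroʳ (parity q))

parity-odd : ∀ q → parity (suc (q + q)) ≡ 1ℙ
parity-odd q = trans (+-homo-+ 1 (q + q)) (cong (1ℙ ⊕_) (trans (+-homo-+ q q) (p+p≡0ℙ (parity q))))

2∤odd : ∀ q → ¬ 2 ∣ℕ suc (q + q)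
2∤odd q 2∣ with trans (sym (parity-odd q)) (2∣⇒parity≡0ℙ 2∣)
... | ()

parityℤ : ℤ → Parity
parityℤ z = parity ∣ z ∣

parityℤ-⊖ : ∀ m n → parityℤ (m ⊖ n) ≡ parity m ⊕ parity n
parityℤ-⊖ m       zero    = sym (+-identityʳ (parity m))
parityℤ-⊖ zero    (suc n) = refl
parityℤ-⊖ (suc m) (suc n) = begin
  parityℤ (suc m ⊖ suc n)          ≡⟨ cong parityℤ ([1+m]⊖[1+n]≡m⊖n m n) ⟩
  parityℤ (m ⊖ n)                  ≡⟨ parityℤ-⊖ m n ⟩
  parity m ⊕ parity n              ≡⟨ parity-suc-suc m n ⟨
  parity (suc m) ⊕ parity (suc n)  ∎

parityℤ-+ : ∀ x y → parityℤ (x ℤ.+ y) ≡ parityℤ x ⊕ parityℤ y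
parityℤ-+ (+ m)    (+ n)    = +-homo-+ m n
parityℤ-+ (+ m)    -[1+ n ] = parityℤ-⊖ m (suc n)
parityℤ-+ -[1+ m ] (+ n)    = trans (parityℤ-⊖ n (suc m)) (+-comm (parity n) _)
parityℤ-+ -[1+ m ] -[1+ n ] = trans (+-homo-+ m n) (sym (parity-suc-suc m n))

parityℤ-* : ∀ x y → parityℤ (x ℤ.* y) ≡ parityℤ x · parityℤ y
parityℤ-* x y = trans (cong parity (abs-* x y)) (*-homo-* ∣ x ∣ ∣ y ∣)

parityℤ≡0ℙ⇒2∣ : ∀ z → parityℤ z ≡ 0ℙ → + 2 ∣ z
parityℤ≡0ℙ⇒2∣ z = parity≡0ℙ⇒2∣ ∣ z ∣

parityℤ≡1ℙ⇒2∣z-1 : ∀ z → parityℤ z ≡ 1ℙ → + 2 ∣ z - + 1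
parityℤ≡1ℙ⇒2∣z-1 z z-odd = parityℤ≡0ℙ⇒2∣ (z - + 1) (trans (parityℤ-+ z -1ℤ) (cong (_⊕ 1ℙ) z-odd))

parityℤ-[-1]^ : ∀ k → parityℤ (-1ℤ ℤ.^ k) ≡ 1ℙ
parityℤ-[-1]^ zero    = refl
parityℤ-[-1]^ (suc k) = trans (parityℤ-* -1ℤ (-1ℤ ℤ.^ k)) (parityℤ-[-1]^ k)

parityℤ-sumFin : ∀ n (g : Fin n → ℤ) → parityℤ (sumFin n g) ≡ ∑[ i < n ] parityℤ (g i)
parityℤ-sumFin zero    g = refl
parityℤ-sumFin (suc n) g = trans (parityℤ-+ (g zero) _) (cong (parityℤ (g zero) ⊕_) (parityℤ-sumFin n (g ∘ suc)))

parityℤ-sumℕ : ∀ n g → parityℤ (sumℕ n g) ≡ ∑ℕ n (parityℤ ∘ g)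
parityℤ-sumℕ zero    g = refl
parityℤ-sumℕ (suc n) g = begin
  parityℤ (sumℕ n g ℤ.+ g n)           ≡⟨ parityℤ-+ (sumℕ n g) (g n) ⟩
  parityℤ (sumℕ n g) ⊕ parityℤ (g n)   ≡⟨ cong (_⊕ parityℤ (g n)) (parityℤ-sumℕ n g) ⟩
  ∑ℕ n (parityℤ ∘ g) ⊕ parityℤ (g n)   ≡⟨ ∑ℕ-suc n (parityℤ ∘ g) ⟨
  ∑ℕ (suc n) (parityℤ ∘ g)             ∎

-- The sign (-1)^j of the Laplace expansion is invisible mod 2.
parityℤ-det : ∀ n (M : Fin n → Fin n → ℤ) → parityℤ (det n M) ≡ detℙ n (λ i j → parityℤ (M i j))
parityℤ-det zero    M = refl
parityℤ-det (suc n) M = trans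
  (parityℤ-sumFin (suc n) (λ j → (-1ℤ ℤ.^ toℕ j) ℤ.* (M zero j ℤ.* det n (λ r c → M (suc r) (punchIn j c)))))
  (sum-cong-≗ term)
  where
  term : ∀ j → parityℤ ((-1ℤ ℤ.^ toℕ j) ℤ.* (M zero j ℤ.* det n (λ r c → M (suc r) (punchIn j c))))
             ≡ parityℤ (M zero j) · detℙ n (minor j (λ i j → parityℤ (M i j)))
  term j = begin
    parityℤ ((-1ℤ ℤ.^ toℕ j) ℤ.* (M zero j ℤ.* D))
      ≡⟨ parityℤ-* (-1ℤ ℤ.^ toℕ j) _ ⟩
    parityℤ (-1ℤ ℤ.^ toℕ j) · parityℤ (M zero j ℤ.* D)
      ≡⟨ cong (_· parityℤ (M zero j ℤ.* D)) (parityℤ-[-1]^ (toℕ j)) ⟩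
    parityℤ (M zero j ℤ.* D)
      ≡⟨ parityℤ-* (M zero j) D ⟩
    parityℤ (M zero j) · parityℤ D
      ≡⟨ cong (parityℤ (M zero j) ·_) (parityℤ-det n (λ r c → M (suc r) (punchIn j c))) ⟩
    parityℤ (M zero j) · detℙ n (minor j (λ i j → parityℤ (M i j))) ∎
    where D = det n (λ r c → M (suc r) (punchIn j c))

divisibleℙ : ℕ → ℕ → Parity
divisibleℙ d N with d ∣? N
... | yes _ = 1ℙ
... | no  _ = 0ℙ

divisibleℙ-1 : ∀ N → divisibleℙ 1 N ≡ 1ℙ
divisibleℙ-1 N with 1 ∣? N
... | yes _  = refl
... | no 1∤N = ⊥-elim (1∤N (1∣ N))

divisibleℙ-> : ∀ d N → d > suc N → divisibleℙ d (suc N) ≡ 0ℙ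
divisibleℙ-> d N d>N with d ∣? suc N
... | yes d∣N = ⊥-elim (>⇒∤ d>N d∣N)
... | no _    = refl

divisibleℙ-2* : ∀ d N → divisibleℙ (2 * d) (2 * N) ≡ divisibleℙ d N
divisibleℙ-2* d N with 2 * d ∣? 2 * N | d ∣? N
... | yes _   | yes _   = refl
... | no _    | no _    = refl
... | yes 2d∣ | no d∤   = ⊥-elim (d∤ (*-cancelˡ-∣ 2 2d∣))
... | no 2d∤  | yes d∣  = ⊥-elim (2d∤ (*-monoʳ-∣ 2 d∣))

n<2^n : ∀ n → n < 2 ^ n
n<2^n zero    = s≤s z≤n
n<2^n (suc n) = +-mono-≤ (m^n>0 2 n) (≤-trans (n<2^n n) (m≤m+n (2 ^ n) 0))

-- The parity of the 2-adic valuation of N, for N ≥ 1.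
ν₂ℙ : ℕ → Parity
ν₂ℙ N = ∑ℕ N (λ k → divisibleℙ (2 ^ suc k) N)

ν₂ℙ-odd : ∀ q → ν₂ℙ (suc (q + q)) ≡ 0ℙ
ν₂ℙ-odd q = ∑ℕ-vanish (suc (q + q)) _ (λ k _ → odd-not-divisible k)
  where
  odd-not-divisible : ∀ k → divisibleℙ (2 ^ suc k) (suc (q + q)) ≡ 0ℙ
  odd-not-divisible k with 2 ^ suc k ∣? suc (q + q)
  ... | yes 2^k+1∣ = ⊥-elim (2∤odd q (∣-trans (m∣m*n (2 ^ k)) 2^k+1∣))
  ... | no _       = refl

ν₂ℙ-double : ∀ M′ → ν₂ℙ (suc M′ + suc M′) ≡ 1ℙ ⊕ ν₂ℙ (suc M′)
ν₂ℙ-double M′ = begin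
  ν₂ℙ (M + M)
    ≡⟨ ∑ℕ-cong (M + M) (λ k _ → halve k) ⟩
  ∑ℕ (M + M) (λ k → divisibleℙ (2 ^ k) M)
    ≡⟨ cong (_⊕ ∑ℕ (M′ + M) h) (divisibleℙ-1 M) ⟩
  1ℙ ⊕ ∑ℕ (M′ + M) h
    ≡⟨ cong (λ n → 1ℙ ⊕ ∑ℕ n h) (+ℕ-comm M′ M) ⟩
  1ℙ ⊕ ∑ℕ (M + M′) h
    ≡⟨ cong (1ℙ ⊕_) (∑ℕ-+ M M′ h) ⟩
  1ℙ ⊕ (ν₂ℙ M ⊕ ∑ℕ M′ (λ t → h (M + t)))
    ≡⟨ cong (λ x → 1ℙ ⊕ (ν₂ℙ M ⊕ x)) (∑ℕ-vanish M′ _ (λ t _ → too-big t)) ⟩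
  1ℙ ⊕ (ν₂ℙ M ⊕ 0ℙ)
    ≡⟨ cong (1ℙ ⊕_) (+-identityʳ (ν₂ℙ M)) ⟩
  1ℙ ⊕ ν₂ℙ M ∎
  where
  M = suc M′
  h = λ k → divisibleℙ (2 ^ suc k) M
  halve : ∀ k → divisibleℙ (2 ^ suc k) (M + M) ≡ divisibleℙ (2 ^ k) M
  halve k = trans (cong (divisibleℙ (2 ^ suc k)) (double M)) (divisibleℙ-2* (2 ^ k) M)
    where
    double : ∀ n → n + n ≡ 2 * n
    double = solve-∀
  too-big : ∀ t → h (M + t) ≡ 0ℙ
  too-big t = divisibleℙ-> (2 ^ suc (M + t)) M′ (≤-trans (s≤s (m≤m+n M t)) (<⇒≤ (n<2^n (suc (M + t)))))

parityℤ-geoCoeff : ∀ d e → parityℤ (geoCoeff d (suc e)) ≡ divisibleℙ d (suc e)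
parityℤ-geoCoeff d e with d ∣? suc e
... | yes (divides zero ())
... | yes (divides (suc q) _) = parityℤ-[-1]^ q
... | no _                    = refl

-- fℙ i is the coefficient of x^(i+2) in Σₖ x^(2^(k+1)) / (1 + x^(2^(k+1))) over 𝔽₂.
fℙ : Series
fℙ i = ν₂ℙ (2 + i)

parityℤ-fCoeff : ∀ i → parityℤ (fCoeff i) ≡ fℙ i
parityℤ-fCoeff i = begin
  parityℤ (sumℕ (i + 2) (λ k → geoCoeff (2 ^ suc k) (i + 2)))
    ≡⟨ cong (λ N → parityℤ (sumℕ N (λ k → geoCoeff (2 ^ suc k) N))) (+ℕ-comm i 2) ⟩
  parityℤ (sumℕ (2 + i) (λ k → geoCoeff (2 ^ suc k) (2 + i)))
    ≡⟨ parityℤ-sumℕ (2 + i) (λ k → geoCoeff (2 ^ suc k) (2 + i)) ⟩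
  ∑ℕ (2 + i) (λ k → parityℤ (geoCoeff (2 ^ suc k) (2 + i)))
    ≡⟨ ∑ℕ-cong (2 + i) (λ k _ → parityℤ-geoCoeff (2 ^ suc k) (suc i)) ⟩
  fℙ i ∎

fℙ-odd : ∀ j → fℙ (suc (j + j)) ≡ 0ℙ
fℙ-odd j = trans (cong (λ x → ν₂ℙ (2 + x)) (sym (+-suc j j))) (ν₂ℙ-odd (suc j))

fℙ-even : ∀ j → fℙ (2 + (j + j)) ≡ 1ℙ ⊕ fℙ j
fℙ-even j = trans (cong (λ x → ν₂ℙ (2 + x)) (sym (trans (+-suc j (suc j)) (cong suc (+-suc j j)))))
                  (ν₂ℙ-double (suc j))

parityℤ-H : ∀ n → parityℤ (H n) ≡ Hℙ n fℙ
parityℤ-H n = trans (parityℤ-det n (λ i j → fCoeff (toℕ i + toℕ j)))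
                    (detℙ-cong n (λ i j → parityℤ-fCoeff (toℕ i + toℕ j)))

open PeriodSix fℙ refl fℙ-odd fℙ-even

proposition3p8 : (m : ℕ) →
    ((+ 2) ∣ (H (6 * m) - + 1)) × ((+ 2) ∣ (H (6 * m + 1) - + 1)) ×
    ((+ 2) ∣ H (6 * m + 2)) × ((+ 2) ∣ H (6 * m + 3)) ×
    ((+ 2) ∣ (H (6 * m + 4) - + 1)) × ((+ 2) ∣ (H (6 * m + 5) - + 1))
proposition3p8 m =
  subst (λ n → + 2 ∣ H n - + 1) (+ℕ-identityʳ (6 * m)) (odd-at 0 refl) ,
  odd-at 1 Hℙ₁ , even-at 2 Hℙ₂ , even-at 3 Hℙ₃ , odd-at 4 Hℙ₄ , odd-at 5 Hℙ₅
  where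
  H≡ : ∀ r → parityℤ (H (6 * m + r)) ≡ Hℙ r fℙ
  H≡ r = trans (parityℤ-H (6 * m + r)) (Hℙ-period-6m m r)
  odd-at : ∀ r → Hℙ r fℙ ≡ 1ℙ → + 2 ∣ H (6 * m + r) - + 1
  odd-at r Hℙr≡1 = parityℤ≡1ℙ⇒2∣z-1 (H (6 * m + r)) (trans (H≡ r) Hℙr≡1)
  even-at : ∀ r → Hℙ r fℙ ≡ 0ℙ → + 2 ∣ H (6 * m + r)
  even-at r Hℙr≡0 = parityℤ≡0ℙ⇒2∣ (H (6 * m + r)) (trans (H≡ r) Hℙr≡0)
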